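{- If $\mathcal H$ is an FLP-tight simple program and $I$ is an FT-stable model of $\mathcal H$, then for every non-empty subset $X\subseteq I$, $I\not\models(\mathcal H^+)^X_\bot$.
   Context: Infinitary propositional formulas: atoms, arbitrary conjunctions $\mathcal H^\land$, disjunctions $\mathcal H^\lor$, implications; $\top=\emptyset^\land$, $\bot=\emptyset^\lor$, $\neg F=F\to\bot$; interpretations are sets of atoms with the usual satisfaction. FT-reduct: $FT(p,I)=p$ if $p\in I$, else $\bot$; $FT(\mathcal H^\land,I)=\{FT(F,I):F\in\mathcal H\}^\land$, likewise for $\lor$; $FT(F\to F',I)=\bot$ if $I\not\models F\to F'$, else $FT(F,I)\to FT(F',I)$; elementwise for sets. $I$ is an FT-stable model of $\mathcal H$ if it is a $\subseteq$-minimal model of $FT(\mathcal H,I)$. Extended literals: $p,\neg p,\neg\neg p$. A simple disjunction is a disjunction of extended literals; a simple implication is $\mathcal A^\land\to\mathcal L^\lor$ with $\mathcal A$ a set of atoms and $\mathcal L^\lor$ a simple disjunction; a simple formula is a conjunction of simple implications; a simple rule is $G\to H$ with $G$ a simple formula and $H$ a disjunction of atoms; a simple program is a set of simple rules. An atom $q$ occurs positively in $G$ if $q$ or $\neg\neg q$ belongs to $\mathcal L$ for some conjunctive term $\mathcal A^\land\to\mathcal L^\lor$ of $G$. The dependency graph of $\mathcal H$ has the atoms of $\mathcal H$ as vertices and an edge $p\to q$ if for some $G\to H\in\mathcal H$, $p$ is a disjunctive term of $H$ and $q$ occurs positively in $G$; it is FLP-critical if for some $G\to H\in\mathcal H$,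 $p$ is a disjunctive term of $H$ and $\neg\neg q\in\mathcal L$ for some conjunctive term of $G$. $\mathcal H$ is FLP-tight if no path in this graph contains infinitely many FLP-critical edges. $F^+$ replaces each $\neg\neg p$ in $F$ by $p$. For a set $X$ of atoms: for a simple disjunction $F$, $F^X_\bot$ removes disjunctive terms belonging to $X$; for a simple implication $F=\mathcal A^\land\to\mathcal L^\lor$, $F^X_\bot$ is $F$ if $\mathcal A\cap X\ne\emptyset$ and $\mathcal A^\land\to(\mathcal L^\lor)^X_\bot$ otherwise; termwise for simple formulas; for simple programs each $G\to H$ becomes $G^X_\bot\to H^X_\bot$. -}

module Defs where

open import Data.Nat using (ℕ; suc; _≤_)
open import Data.Product using (Σ; _×_; _,_; proj₁; proj₂)
open import Data.Sum using (_⊎_)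
open import Data.Empty using (⊥)
open import Relation.Nullary using (¬_; Dec; yes; no)
open import Relation.Binary.PropositionalEquality using (_≡_)

-- Classical metatheory: excluded middle, supplied as an explicit
-- hypothesis (needed to *define* the FT-reduct and ( )^X_⊥, which
-- branch on undecidable conditions).

EM : Set₁
EM = (P : Set) → Dec P

data Formula (A : Set) : Set₁ where
  atom : A → Formula A
  ⋀    : (K : Set) → (K → Formula A) → Formula A
  ⋁    : (K : Set) → (K → Formula A) → Formula A
  _⇒_  : Formula A → Formula A → Formula A

module _ {A : Set} where

  ⊤ᶠ : Formula A
  ⊤ᶠ = ⋀ ⊥ (λ ())

  ⊥ᶠ : Formula A
  ⊥ᶠ = ⋁ ⊥ (λ ())

  ¬ᶠ : Formula A → Formula A
  ¬ᶠ F = F ⇒ ⊥ᶠ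

record FormulaSet (A : Set) : Set₁ where
  constructor fset
  field
    Idx  : Set
    elem : Idx → Formula A
open FormulaSet public

Interp : Set → Set₁
Interp A = A → Set

_⊆_ : {A : Set} → Interp A → Interp A → Set
X ⊆ Y = ∀ a → X a → Y a

_⊨_ : {A : Set} → Interp A → Formula A → Set
I ⊨ atom p  = I p
I ⊨ ⋀ K F   = (k : K) → I ⊨ F k
I ⊨ ⋁ K F   = Σ K (λ k → I ⊨ F k)
I ⊨ (F ⇒ G) = I ⊨ F → I ⊨ G

_⊨ˢ_ : {A : Set} → Interp A → FormulaSet A → Set
I ⊨ˢ H = (k : Idx H) → I ⊨ elem H k

FT : {A : Set} → EM → Interp A → Formula A → Formula A
FT lem I (atom p) with lem (I p)
... | yes _ = atom p
... | no  _ = ⊥ᶠ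
FT lem I (⋀ K F) = ⋀ K (λ k → FT lem I (F k))
FT lem I (⋁ K F) = ⋁ K (λ k → FT lem I (F k))
FT lem I (F ⇒ G) with lem (I ⊨ (F ⇒ G))
... | yes _ = FT lem I F ⇒ FT lem I G
... | no  _ = ⊥ᶠ

FTˢ : {A : Set} → EM → Interp A → FormulaSet A → FormulaSet A
FTˢ lem I H = fset (Idx H) (λ k → FT lem I (elem H k))

MinimalModel : {A : Set} → Interp A → FormulaSet A → Set₁
MinimalModel I S = I ⊨ˢ S × ((J : Interp _) → J ⊆ I → J ⊨ˢ S → I ⊆ J)

FTStable : {A : Set} → EM → FormulaSet A → Interp A → Set₁
FTStable lem H I = MinimalModel I (FTˢ lem I H)

data ExtLit (A : Set) : Set where
  pos    : A → ExtLit A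
  neg    : A → ExtLit A
  negneg : A → ExtLit A

record SimpleImp (A : Set) : Set₁ where
  constructor simp
  field
    AIdx : Set
    𝒜    : AIdx → A
    LIdx : Set
    𝓛    : LIdx → ExtLit A
open SimpleImp public

record SimpleRule (A : Set) : Set₁ where
  constructor srule
  field
    GIdx : Set
    G    : GIdx → SimpleImp A
    HIdx : Set
    H    : HIdx → A
open SimpleRule public

record SimpleProgram (A : Set) : Set₁ where
  constructor sprog
  field
    RIdx : Set
    rule : RIdx → SimpleRule A
open SimpleProgram public

litF : {A : Set} → ExtLit A → Formula A
litF (pos p)    = atom p
litF (neg p)    = ¬ᶠ (atom p)
litF (negneg p) = ¬ᶠ (¬ᶠ (atom p))

impF : {A : Set} → SimpleImp A → Formula A
impF i = ⋀ (AIdx i) (λ a → atom (𝒜 i a)) ⇒ ⋁ (LIdx i) (λ l → litF (𝓛 i l))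

ruleF : {A : Set} → SimpleRule A → Formula A
ruleF r = ⋀ (GIdx r) (λ k → impF (G r k)) ⇒ ⋁ (HIdx r) (λ j → atom (H r j))

progF : {A : Set} → SimpleProgram A → FormulaSet A
progF P = fset (RIdx P) (λ r → ruleF (rule P r))

InHead : {A : Set} → A → SimpleRule A → Set
InHead p r = Σ (HIdx r) (λ j → H r j ≡ p)

OccursPos : {A : Set} → A → SimpleRule A → Set
OccursPos q r = Σ (GIdx r) (λ k → Σ (LIdx (G r k)) (λ l →
                  (𝓛 (G r k) l ≡ pos q) ⊎ (𝓛 (G r k) l ≡ negneg q)))

OccursNegNeg : {A : Set} → A → SimpleRule A → Set
OccursNegNeg q r = Σ (GIdx r) (λ k → Σ (LIdx (G r k)) (λ l →
                     𝓛 (G r k) l ≡ negneg q))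

Edge : {A : Set} → SimpleProgram A → A → A → Set
Edge P p q = Σ (RIdx P) (λ r → InHead p (rule P r) × OccursPos q (rule P r))

Critical : {A : Set} → SimpleProgram A → A → A → Set
Critical P p q = Σ (RIdx P) (λ r → InHead p (rule P r) × OccursNegNeg q (rule P r))

FLPTight : {A : Set} → SimpleProgram A → Set
FLPTight {A} P = ¬ Σ (ℕ → A) (λ v →
    ((i : ℕ) → Edge P (v i) (v (suc i)))
  × ((n : ℕ) → Σ ℕ (λ m → n ≤ m × Critical P (v m) (v (suc m)))))

litPlus : {A : Set} → ExtLit A → ExtLit A
litPlus (pos p)    = pos p
litPlus (neg p)    = neg p
litPlus (negneg p) = pos p

impPlus : {A : Set} → SimpleImp A → SimpleImp A
impPlus i = simp (AIdx i) (𝒜 i) (LIdx i) (λ l → litPlus (𝓛 i l))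

rulePlus : {A : Set} → SimpleRule A → SimpleRule A
rulePlus r = srule (GIdx r) (λ k → impPlus (G r k)) (HIdx r) (H r)

progPlus : {A : Set} → SimpleProgram A → SimpleProgram A
progPlus P = sprog (RIdx P) (λ r → rulePlus (rule P r))

LitIn : {A : Set} → Interp A → ExtLit A → Set
LitIn X (pos p)    = X p
LitIn X (neg p)    = ⊥
LitIn X (negneg p) = ⊥

impBot : {A : Set} → EM → Interp A → SimpleImp A → SimpleImp A
impBot lem X i with lem (Σ (AIdx i) (λ a → X (𝒜 i a)))
... | yes _ = i
... | no  _ = simp (AIdx i) (𝒜 i)
                   (Σ (LIdx i) (λ l → ¬ LitIn X (𝓛 i l)))
                   (λ l → 𝓛 i (proj₁ l))

ruleBot : {A : Set} → EM → Interp A → SimpleRule A → SimpleRule A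
ruleBot lem X r = srule (GIdx r) (λ k → impBot lem X (G r k))
                        (Σ (HIdx r) (λ j → ¬ X (H r j)))
                        (λ j → H r (proj₁ j))

progBot : {A : Set} → EM → Interp A → SimpleProgram A → SimpleProgram A
progBot lem X P = sprog (RIdx P) (λ r → ruleBot lem X (rule P r))

module Submission where

open import Defs
open import Data.Product using (Σ; _×_; _,_; proj₁; proj₂)
open import Data.Sum using (inj₁; inj₂)
open import Data.Empty using (⊥-elim)
open import Data.Unit using (⊤)
open import Data.Nat using (ℕ; zero; suc; _≤_; z≤n; s≤s)
open import Data.Nat.GeneralisedArithmetic using (iterate)
open import Relation.Nullary using (¬_; yes; no)
open import Relation.Nullary.Decidable using (decidable-stable)
open import Relation.Binary.PropositionalEquality using (refl)
open import Relation.Binary.Construct.Closure.ReflexiveTransitive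
  using (Star; ε; _◅_; _◅◅_; map)

-- Suppose I ⊨ (ℋ⁺)^X_⊥. Deleting from I a set R ⊆ X that is closed under edges into X
-- and has no FLP-critical edge into X leaves a model of FT(ℋ, I): a rule whose head
-- lost an atom to R has, by closure, a body whose reduct still holds in I, so the
-- reduct's head supplies a head atom of I outside X. Minimality of I forces R = ∅.
-- Hence the atoms reachable inside X from any q ∈ X have a critical edge back into X,
-- and chaining these finite segments gives an infinite path with infinitely many
-- critical edges, contradicting FLP-tightness.

InfinitelyCriticalPath : {A : Set} → (A → A → Set) → (A → A → Set) → Set
InfinitelyCriticalPath {A} E C = Σ (ℕ → A) λ v →
    ((i : ℕ) → E (v i) (v (suc i)))
  × ((n : ℕ) → Σ ℕ λ m → n ≤ m × C (v m) (v (suc m)))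

module _ {A : Set} (E C : A → A → Set) (X : A → Set) where

  record Segment (x : A) : Set where
    constructor segment
    field
      {mid end} : A
      path      : Star E x mid
      critical  : C mid end
      lands     : X end

  module _ (C⇒E : ∀ {x y} → C x y → E x y) (segment-from : ∀ {x} → X x → Segment x) where

    private
      State : Set
      State = Σ A Segment

      advance : State → State
      advance (_ , segment ε _ z∈X)        = _ , segment-from z∈X
      advance (_ , segment (_ ◅ p) c z∈X) = _ , segment p c z∈X

      position : State → ℕ → A
      position s n = proj₁ (iterate advance s n)

      edge-at : ∀ s i → E (position s i) (position s (suc i))
      edge-at (_ , segment ε c _)       zero    = C⇒E c
      edge-at (_ , segment (e ◅ _) _ _) zero    = e
      edge-at s                         (suc i) = edge-at (advance s) i

      critical-soon : ∀ {x y z} (p : Star E x y) (c : C y z) (z∈X : X z) →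
        Σ ℕ λ d → C (position (x , segment p c z∈X) d)
                    (position (x , segment p c z∈X) (suc d))
      critical-soon ε       c _   = zero , c
      critical-soon (_ ◅ p) c z∈X with critical-soon p c z∈X
      ... | d , c′ = suc d , c′

      critical-after : ∀ n s → Σ ℕ λ m → n ≤ m × C (position s m) (position s (suc m))
      critical-after zero (_ , segment p c z∈X) with critical-soon p c z∈X
      ... | d , c′ = d , z≤n , c′
      critical-after (suc n) s with critical-after n (advance s)
      ... | m , n≤m , c = suc m , s≤s n≤m , c

    infinitely-critical-path : ∀ {x} → X x → InfinitelyCriticalPath E C
    infinitely-critical-path x∈X =
      position s₀ , edge-at s₀ , λ n → critical-after n s₀
      where
      s₀ : State
      s₀ = _ , segment-from x∈X

¬¬-elim : EM → {P : Set} → ¬ ¬ P → P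
¬¬-elim lem = decidable-stable (lem _)

_∖_ : {A : Set} → Interp A → Interp A → Interp A
(I ∖ R) a = I a × ¬ R a

Guarded : {A : Set} → Interp A → Interp A → ExtLit A → Set
Guarded X R (pos p)    = X p → R p
Guarded X R (neg p)    = ⊤
Guarded X R (negneg p) = ¬ X p

module _ {A : Set} (lem : EM) (I : Interp A) where

  FT-sound : {J : Interp A} (F : Formula A) → J ⊨ FT lem I F → I ⊨ F
  FT-sound (atom p) with lem (I p)
  ... | yes p∈I = λ _ → p∈I
  ... | no  _   = λ ()
  FT-sound (⋀ K F) J⊨ k        = FT-sound (F k) (J⊨ k)
  FT-sound (⋁ K F) (k , J⊨)    = k , FT-sound (F k) J⊨
  FT-sound (F ⇒ G) with lem (I ⊨ (F ⇒ G))
  ... | yes I⊨F⇒G = λ _ → I⊨F⇒G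
  ... | no  _     = λ ()

  FT-atom⁺ : {J : Interp A} → J ⊆ I → ∀ p → J p → J ⊨ FT lem I (atom p)
  FT-atom⁺ J⊆I p p∈J with lem (I p)
  ... | yes _   = p∈J
  ... | no  p∉I = ⊥-elim (p∉I (J⊆I p p∈J))

  FT-atom⁻ : {J : Interp A} → ∀ p → J ⊨ FT lem I (atom p) → J p
  FT-atom⁻ p with lem (I p)
  ... | yes _ = λ p∈J → p∈J
  ... | no  _ = λ ()

  FT-⇒-intro : {J : Interp A} (F G : Formula A) → I ⊨ (F ⇒ G) →
    (J ⊨ FT lem I F → J ⊨ FT lem I G) → J ⊨ FT lem I (F ⇒ G)
  FT-⇒-intro F G I⊨F⇒G f with lem (I ⊨ (F ⇒ G))
  ... | yes _  = f
  ... | no  I⊭ = ⊥-elim (I⊭ I⊨F⇒G)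

  FT-⇒-elim : {J : Interp A} (F G : Formula A) →
    J ⊨ FT lem I (F ⇒ G) → J ⊨ FT lem I F → J ⊨ FT lem I G
  FT-⇒-elim F G with lem (I ⊨ (F ⇒ G))
  ... | yes _ = λ f → f
  ... | no  _ = λ ()

  ⊨-litPlus : ∀ e → I ⊨ litF e → I ⊨ litF (litPlus e)
  ⊨-litPlus (pos p)    p∈I = p∈I
  ⊨-litPlus (neg p)    p∉I = p∉I
  ⊨-litPlus (negneg p) ¬¬p = ¬¬-elim lem λ p∉I → proj₁ (¬¬p λ p∈I → ⊥-elim (p∉I p∈I))

  ⊨-impPlus : ∀ i → I ⊨ impF i → I ⊨ impF (impPlus i)
  ⊨-impPlus i I⊨i 𝒜⊆I with I⊨i 𝒜⊆I
  ... | l , I⊨l = l , ⊨-litPlus (𝓛 i l) I⊨l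

  module _ (X R : Interp A) where

    FT-lit-∉X : ∀ e → Guarded X R e → (I ∖ R) ⊨ FT lem I (litF e) → ¬ LitIn X (litPlus e)
    FT-lit-∉X (pos p)    p∈X⇒p∈R J⊨p p∈X = proj₂ (FT-atom⁻ p J⊨p) (p∈X⇒p∈R p∈X)
    FT-lit-∉X (neg p)    _       _   ()
    FT-lit-∉X (negneg p) p∉X     _   = p∉X

    FT-imp-impBot : R ⊆ X → ∀ i → (∀ l → Guarded X R (𝓛 i l)) →
      (I ∖ R) ⊨ FT lem I (impF i) → I ⊨ impF (impBot lem X (impPlus i))
    FT-imp-impBot R⊆X i guarded J⊨i with lem (Σ (AIdx i) (λ a → X (𝒜 i a)))
    ... | yes _   = ⊨-impPlus i (FT-sound (impF i) J⊨i)
    ... | no  𝒜∌X = λ 𝒜⊆I → surviving (FT-⇒-elim _ _ J⊨i λ a →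
                      FT-atom⁺ (λ _ → proj₁) (𝒜 i a) (𝒜⊆I a , λ 𝒜a∈R → 𝒜∌X (a , R⊆X _ 𝒜a∈R)))
      where
      surviving : Σ (LIdx i) (λ l → (I ∖ R) ⊨ FT lem I (litF (𝓛 i l))) →
        Σ (Σ (LIdx i) λ l → ¬ LitIn X (litPlus (𝓛 i l)))
          λ l → I ⊨ litF (litPlus (𝓛 i (proj₁ l)))
      surviving (l , J⊨l) =
        (l , FT-lit-∉X (𝓛 i l) (guarded l) J⊨l) ,
        ⊨-litPlus (𝓛 i l) (FT-sound (litF (𝓛 i l)) J⊨l)

    FT-rule-∖ : R ⊆ X → ∀ r → (∀ {j} → R (H r j) → ∀ k l → Guarded X R (𝓛 (G r k) l)) →
      I ⊨ ruleF (ruleBot lem X (rulePlus r)) → I ⊨ ruleF r →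
      (I ∖ R) ⊨ FT lem I (ruleF r)
    FT-rule-∖ R⊆X r guarded I⊨r⁺ I⊨r = FT-⇒-intro _ _ I⊨r λ J⊨body →
      head (I⊨r (λ k → FT-sound (impF (G r k)) (J⊨body k))) J⊨body
      where
      I-heads∈R : ¬ Σ (HIdx r) (λ j → (I ∖ R) (H r j)) → ∀ j → I (H r j) → R (H r j)
      I-heads∈R heads⊈J j Hj∈I = ¬¬-elim lem λ Hj∉R → heads⊈J (j , Hj∈I , Hj∉R)

      head : I ⊨ ⋁ (HIdx r) (λ j → atom (H r j)) →
        (I ∖ R) ⊨ FT lem I (⋀ (GIdx r) λ k → impF (G r k)) →
        (I ∖ R) ⊨ FT lem I (⋁ (HIdx r) λ j → atom (H r j))
      head (j₀ , Hj₀∈I) J⊨body with lem (Σ (HIdx r) λ j → (I ∖ R) (H r j))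
      ... | yes (j , Hj∈J) = j , FT-atom⁺ (λ _ → proj₁) (H r j) Hj∈J
      ... | no  heads⊈J
        with I⊨r⁺ (λ k → FT-imp-impBot R⊆X (G r k)
                           (guarded (I-heads∈R heads⊈J j₀ Hj₀∈I) k) (J⊨body k))
      ...   | (j , Hj∉X) , Hj∈I = ⊥-elim (Hj∉X (R⊆X _ (I-heads∈R heads⊈J j Hj∈I)))

record Closed {A : Set} (P : SimpleProgram A) (X R : Interp A) : Set where
  field
    R⊆X         : R ⊆ X
    edge-closed : ∀ {h p} → R h → Edge P h p → X p → R p
    no-critical : ∀ {h p} → R h → Critical P h p → ¬ X p

module _ {A : Set} {P : SimpleProgram A} {X R : Interp A} (closed : Closed P X R) where
  open Closed closed

  closed-body-guarded : ∀ ρ {j} → R (H (rule P ρ) j) →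
    ∀ k l → Guarded X R (𝓛 (G (rule P ρ) k) l)
  closed-body-guarded ρ {j} Hj∈R k l with 𝓛 (G (rule P ρ) k) l in eq
  ... | pos p    = edge-closed Hj∈R (ρ , (j , refl) , k , l , inj₁ eq)
  ... | neg p    = _
  ... | negneg p = no-critical Hj∈R (ρ , (j , refl) , k , l , eq)

  module _ (lem : EM) {I : Interp A}
           (I⊨reduct : I ⊨ˢ progF (progBot lem X (progPlus P))) where

    FT-prog-∖ : I ⊨ˢ FTˢ lem I (progF P) → (I ∖ R) ⊨ˢ FTˢ lem I (progF P)
    FT-prog-∖ I⊨FT ρ = FT-rule-∖ lem I X R R⊆X (rule P ρ) (closed-body-guarded ρ)
      (I⊨reduct ρ) (FT-sound lem I (ruleF (rule P ρ)) (I⊨FT ρ))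

    stable⇒closed-empty : FTStable lem (progF P) I → X ⊆ I → ∀ a → ¬ R a
    stable⇒closed-empty (I⊨FT , minimal) X⊆I a a∈R =
      proj₂ (minimal (I ∖ R) (λ _ → proj₁) (FT-prog-∖ I⊨FT) a (X⊆I a (R⊆X a a∈R))) a∈R

EdgeInto : {A : Set} → SimpleProgram A → Interp A → A → A → Set
EdgeInto P X h p = Edge P h p × X p

ReachableWithin : {A : Set} → SimpleProgram A → Interp A → A → Interp A
ReachableWithin P X q h = X q × Star (EdgeInto P X) q h

CriticalExit : {A : Set} → SimpleProgram A → Interp A → A → Set
CriticalExit {A} P X q = Σ A λ h → Σ A λ p → ReachableWithin P X q h × Critical P h p × X p

module _ {A : Set} {P : SimpleProgram A} {X : Interp A} where

  reachable-∈ : ∀ {q h} → ReachableWithin P X q h → X h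
  reachable-∈ (q∈X , path) = last q∈X path
    where
    last : ∀ {x y} → X x → Star (EdgeInto P X) x y → X y
    last x∈X ε                  = x∈X
    last _   ((_ , p∈X) ◅ path) = last p∈X path

  reachable-closed : ∀ {q} → ¬ CriticalExit P X q → Closed P X (ReachableWithin P X q)
  reachable-closed no-exit = record
    { R⊆X         = λ _ → reachable-∈
    ; edge-closed = λ (q∈X , path) e p∈X → q∈X , path ◅◅ (e , p∈X) ◅ ε
    ; no-critical = λ h∈R c p∈X → no-exit (_ , _ , h∈R , c , p∈X)
    }

  critical-exit : (lem : EM) {I : Interp A} → I ⊨ˢ progF (progBot lem X (progPlus P)) →
    FTStable lem (progF P) I → X ⊆ I → ∀ {q} → X q → CriticalExit P X q
  critical-exit lem I⊨reduct stable X⊆I {q} q∈X = ¬¬-elim lem λ no-exit →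
    stable⇒closed-empty (reachable-closed no-exit) lem I⊨reduct stable X⊆I q (q∈X , ε)

critical⇒edge : {A : Set} (P : SimpleProgram A) {x y : A} → Critical P x y → Edge P x y
critical⇒edge _ (ρ , x∈H , k , l , eq) = ρ , x∈H , k , l , inj₂ eq

lemma10 : {A : Set} (lem : EM) (ℋ : SimpleProgram A) (I : Interp A)
    → FLPTight ℋ
    → FTStable lem (progF ℋ) I
    → (X : Interp A) → X ⊆ I → Σ A X
    → ¬ (I ⊨ˢ progF (progBot lem X (progPlus ℋ)))
lemma10 lem ℋ I tight stable X X⊆I (_ , q∈X) I⊨reduct =
  tight (infinitely-critical-path (Edge ℋ) (Critical ℋ) X (critical⇒edge ℋ) segment-from q∈X)
  where
  segment-from : ∀ {x} → X x → Segment (Edge ℋ) (Critical ℋ) X x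
  segment-from x∈X with critical-exit lem I⊨reduct stable X⊆I x∈X
  ... | _ , _ , (_ , path) , c , p∈X = segment (map proj₁ path) c p∈X
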